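{- Let $T$ be a maximal interesting set in a graph $G$, and let $H$ be a co-connected component of $G[C(T)]$ (the vertex set of a connected component of the complement of $G[C(T)]$) with $|H|\ge 2$. Then $H$ is a handle of $\overline{G}$ and $T$ is a co-handle of $H$ in $\overline{G}$.
   Context: All graphs are finite and simple; $\overline{G}$ is the complement of $G$. For $X\subseteq V$, $N(X)$ is the set of vertices of $V\setminus X$ with a neighbour in $X$, and $C(X)$ is the set of vertices of $V\setminus X$ adjacent to all of $X$. A non-empty set $T$ is interesting in $G$ if the complement of $G[T]$ is connected and $G[C(T)]$ is not a clique; it is maximal if not strictly contained in another interesting set. A handle in a graph $F=(V,E)$ is a subset $H\subset V$ with $|H|\ge 2$ such that $F[H]$ is connected, some connected component $J\neq H$ of $F\setminus N(H)$ satisfies $N(J)=N(H)$, and each vertex of $N(H)$ is adjacent to at least one endpoint of each edge of $F[H]$; any such $J$ is a co-handle of $H$. -}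

module Defs where

open import Data.Nat using (ℕ; _≥_)
open import Data.Fin using (Fin)
open import Data.Fin.Properties using (_≟_)
open import Data.Fin.Subset using (Subset; _∈_; _∉_; _⊆_; ∣_∣)
open import Data.Product using (Σ; ∃; _×_; _,_)
open import Data.Sum using (_⊎_)
open import Relation.Nullary using (¬_; Dec; yes; no; _×-dec_; ¬?)
open import Relation.Binary.PropositionalEquality using (_≡_; _≢_)

record Graph (n : ℕ) : Set₁ where
  field
    Adj    : Fin n → Fin n → Set
    adj?   : ∀ x y → Dec (Adj x y)
    sym    : ∀ {x y} → Adj x y → Adj y x
    irrefl : ∀ {x} → ¬ Adj x x
open Graph public

compl : ∀ {n} → Graph n → Graph n
compl G = record
  { Adj    = λ x y → x ≢ y × ¬ Adj G x y
  ; adj?   = λ x y → ¬? (x ≟ y) ×-dec ¬? (adj? G x y)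
  ; sym    = λ { (x≢y , ¬a) → (λ e → x≢y (Relation.Binary.PropositionalEquality.sym e))
                             , (λ a → ¬a (Graph.sym G a)) }
  ; irrefl = λ { (x≢x , _) → x≢x Relation.Binary.PropositionalEquality.refl }
  }

mem : ∀ {n} → Subset n → Fin n → Set
mem X v = v ∈ X

InN : ∀ {n} → Graph n → Subset n → Fin n → Set
InN G X v = v ∉ X × ∃ λ x → x ∈ X × Adj G x v

InC : ∀ {n} → Graph n → Subset n → Fin n → Set
InC G X v = v ∉ X × (∀ x → x ∈ X → Adj G x v)

data Walk {n} (G : Graph n) (S : Fin n → Set) : Fin n → Fin n → Set where
  stop : ∀ {x} → S x → Walk G S x x
  step : ∀ {x y z} → S x → Adj G x y → Walk G S y z → Walk G S x z

Connected : ∀ {n} → Graph n → (Fin n → Set) → Set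
Connected G S = ∀ x y → S x → S y → Walk G S x y

IsClique : ∀ {n} → Graph n → (Fin n → Set) → Set
IsClique G S = ∀ x y → S x → S y → x ≢ y → Adj G x y

IsComponent : ∀ {n} → Graph n → (Fin n → Set) → Subset n → Set
IsComponent G S J =
  (∀ v → v ∈ J → S v) ×
  (∃ λ v → v ∈ J) ×
  Connected G (mem J) ×
  (∀ x y → x ∈ J → S y → Adj G x y → y ∈ J)

Interesting : ∀ {n} → Graph n → Subset n → Set
Interesting G T =
  (∃ λ v → v ∈ T) ×
  Connected (compl G) (mem T) ×
  ¬ IsClique G (InC G T)

MaximalInteresting : ∀ {n} → Graph n → Subset n → Set
MaximalInteresting G T =
  Interesting G T × (∀ T' → Interesting G T' → T ⊆ T' → T ≡ T')

SameN : ∀ {n} → Graph n → Subset n → Subset n → Set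
SameN F J H = ∀ v → (InN F J v → InN F H v) × (InN F H v → InN F J v)

IsCoHandle : ∀ {n} → Graph n → Subset n → Subset n → Set
IsCoHandle F H J =
  IsComponent F (λ v → ¬ InN F H v) J × J ≢ H × SameN F J H

IsHandle : ∀ {n} → Graph n → Subset n → Set
IsHandle F H =
  ∣ H ∣ ≥ 2 ×
  Connected F (mem H) ×
  (∃ λ J → IsCoHandle F H J) ×
  (∀ v → InN F H v → ∀ x y → x ∈ H → y ∈ H → Adj F x y → Adj F v x ⊎ Adj F v y)

{-# OPTIONS --safe #-}
module Submission where

-- Write F for the complement of G. Maximality of T means that a vertex F-adjacent to T and
-- G-adjacent to both ends of an F-edge of C(T) can be added to T keeping it interesting, so it
-- already lies in T. As H ⊆ C(T), every vertex of T is G-adjacent to all of H, so T avoids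
-- N_F(H); and a vertex outside H ∪ N_F(H) is G-adjacent to all of H, which contains an F-edge
-- because |H| ≥ 2. Hence T is closed in F ∖ N_F(H), so it is a component there, and
-- N_F(T) ⊆ N_F(H). Conversely, a vertex of N_F(H) with no F-neighbour in T lies in C(T), hence
-- in the F-component H, which is absurd. The handle condition is absorption once more: a
-- vertex of N_F(H) G-adjacent to both ends of an F-edge of H would be absorbed into T.

open import Defs
open import Data.Nat using (_≤_; _≥_)
open import Data.Nat.Properties using (<⇒≱)
open import Data.Fin using (Fin)
open import Data.Fin.Properties using (any?) renaming (_≟_ to _≟ᶠ_)
open import Data.Fin.Subset using (Subset; _∈_; _∉_; _⊆_; ∣_∣; _∪_; ⁅_⁆)
open import Data.Fin.Subset.Properties
  using (_∈?_; x∈⁅x⁆; x∈⁅y⁆⇒x≡y; p⊆p∪q; x∈p∪q⁺; x∈p∪q⁻; p⊆q⇒∣p∣≤∣q∣; ∣⁅x⁆∣≡1)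
open import Data.Product using (∃; ∃₂; _×_; _,_; proj₁; proj₂)
open import Data.Sum using (_⊎_; inj₁; inj₂)
open import Relation.Nullary using (¬_; Dec; yes; no; _×-dec_; ¬?; contradiction)
open import Relation.Nullary.Decidable using (decidable-stable)
open import Relation.Binary.PropositionalEquality as ≡ using (_≡_; _≢_; refl; subst)

module _ {n} {G : Graph n} where

  walk-mono : ∀ {S S′ : Fin n → Set} → (∀ {v} → S v → S′ v) →
              ∀ {x y} → Walk G S x y → Walk G S′ x y
  walk-mono f (stop s)     = stop (f s)
  walk-mono f (step s a w) = step (f s) a (walk-mono f w)

  _++ʷ_ : ∀ {S x y z} → Walk G S x y → Walk G S y z → Walk G S x z
  stop _     ++ʷ w′ = w′
  step s a w ++ʷ w′ = step s a (w ++ʷ w′)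

  walk-source : ∀ {S x y} → Walk G S x y → S x
  walk-source (stop s)     = s
  walk-source (step s _ _) = s

InN? : ∀ {n} (G : Graph n) X v → Dec (InN G X v)
InN? G X v = ¬? (v ∈? X) ×-dec any? (λ x → x ∈? X ×-dec adj? G x v)

¬InN-compl⇒InC : ∀ {n} (G : Graph n) {X v} → v ∉ X → ¬ InN (compl G) X v → InC G X v
¬InN-compl⇒InC G {X} {v} v∉X v∉N = v∉X , adjacent
  where
  adjacent : ∀ x → x ∈ X → Adj G x v
  adjacent x x∈X with adj? G x v
  ... | yes xv  = xv
  ... | no ¬xv = contradiction (v∉X , x , x∈X , (λ { refl → v∉X x∈X }) , ¬xv) v∉N

∃-other-member : ∀ {n} {X : Subset n} {x} → x ∈ X → ∣ X ∣ ≥ 2 → ∃ λ y → y ∈ X × y ≢ x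
∃-other-member {X = X} {x} x∈X ∣X∣≥2 =
  decidable-stable (any? λ y → y ∈? X ×-dec ¬? (y ≟ᶠ x)) λ none →
    <⇒≱ ∣X∣≥2 (subst (∣ X ∣ ≤_) (∣⁅x⁆∣≡1 x) (p⊆q⇒∣p∣≤∣q∣ (X⊆⁅x⁆ none)))
  where
  X⊆⁅x⁆ : ¬ (∃ λ y → y ∈ X × y ≢ x) → X ⊆ ⁅ x ⁆
  X⊆⁅x⁆ none {y} y∈X with y ≟ᶠ x
  ... | yes refl = x∈⁅x⁆ x
  ... | no y≢x   = contradiction (y , y∈X , y≢x) none

∃-edge : ∀ {n} {G : Graph n} {X : Subset n} → Connected G (mem X) → ∃ (_∈ X) → ∣ X ∣ ≥ 2 →
         ∃₂ λ a b → a ∈ X × b ∈ X × Adj G a b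
∃-edge conn (x , x∈X) ∣X∣≥2 with ∃-other-member x∈X ∣X∣≥2
... | y , y∈X , y≢x with conn x y x∈X y∈X
...   | stop _      = contradiction refl y≢x
...   | step _ xz w = _ , _ , x∈X , walk-source w , xz

∈-∪⁅⁆⁻ : ∀ {n} (X : Subset n) {x y} → x ∈ X ∪ ⁅ y ⁆ → x ∈ X ⊎ x ≡ y
∈-∪⁅⁆⁻ X {y = y} x∈ with x∈p∪q⁻ X ⁅ y ⁆ x∈
... | inj₁ x∈X = inj₁ x∈X
... | inj₂ x∈y = inj₂ (x∈⁅y⁆⇒x≡y y x∈y)

y∈X∪⁅y⁆ : ∀ {n} (X : Subset n) y → y ∈ X ∪ ⁅ y ⁆
y∈X∪⁅y⁆ X y = x∈p∪q⁺ (inj₂ (x∈⁅x⁆ y))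

Connected-∪⁅⁆ : ∀ {n} {F : Graph n} {X : Subset n} {t y} →
                Connected F (mem X) → t ∈ X → Adj F t y → Connected F (mem (X ∪ ⁅ y ⁆))
Connected-∪⁅⁆ {F = F} {X} {t} {y} conn t∈X ty u w u∈ w∈ = join (∈-∪⁅⁆⁻ X u∈) (∈-∪⁅⁆⁻ X w∈)
  where
  widen : ∀ {x z} → Walk F (mem X) x z → Walk F (mem (X ∪ ⁅ y ⁆)) x z
  widen = walk-mono (p⊆p∪q ⁅ y ⁆)
  join : u ∈ X ⊎ u ≡ y → w ∈ X ⊎ w ≡ y → Walk F (mem (X ∪ ⁅ y ⁆)) u w
  join (inj₁ u∈X) (inj₁ w∈X) = widen (conn u w u∈X w∈X)
  join (inj₁ u∈X) (inj₂ refl) = widen (conn u t u∈X t∈X) ++ʷ step (p⊆p∪q ⁅ y ⁆ t∈X) ty (stop w∈)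
  join (inj₂ refl) (inj₁ w∈X) = step u∈ (sym F ty) (widen (conn t w t∈X w∈X))
  join (inj₂ refl) (inj₂ refl) = stop u∈

InC-∪⁅⁆ : ∀ {n} (G : Graph n) {X y c} → InC G X c → Adj G y c → InC G (X ∪ ⁅ y ⁆) c
InC-∪⁅⁆ G {X} {y} {c} (c∉X , Xc) yc = c∉ , adjacent
  where
  c∉ : c ∉ X ∪ ⁅ y ⁆
  c∉ c∈ with ∈-∪⁅⁆⁻ X c∈
  ... | inj₁ c∈X = c∉X c∈X
  ... | inj₂ refl = irrefl G yc
  adjacent : ∀ x → x ∈ X ∪ ⁅ y ⁆ → Adj G x c
  adjacent x x∈ with ∈-∪⁅⁆⁻ X x∈
  ... | inj₁ x∈X = Xc x x∈X
  ... | inj₂ refl = yc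

Interesting-∪⁅⁆ : ∀ {n} (G : Graph n) {T t y a b} → Interesting G T →
                  t ∈ T → Adj (compl G) t y →
                  InC G T a → InC G T b → Adj (compl G) a b → Adj G y a → Adj G y b →
                  Interesting G (T ∪ ⁅ y ⁆)
Interesting-∪⁅⁆ G {T} {y = y} (_ , conn , _) t∈T ty Ca Cb (a≢b , ¬ab) ya yb =
  (y , y∈X∪⁅y⁆ T y) , Connected-∪⁅⁆ conn t∈T ty ,
  λ clique → ¬ab (clique _ _ (InC-∪⁅⁆ G Ca ya) (InC-∪⁅⁆ G Cb yb) a≢b)

maximal-absorbs : ∀ {n} (G : Graph n) {T t y a b} → MaximalInteresting G T →
                  t ∈ T → Adj (compl G) t y →
                  InC G T a → InC G T b → Adj (compl G) a b → Adj G y a → Adj G y b →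
                  y ∈ T
maximal-absorbs G {T} {y = y} (int , maximal) t∈T ty Ca Cb ab ya yb =
  subst (y ∈_) (≡.sym T≡T∪⁅y⁆) (y∈X∪⁅y⁆ T y)
  where
  T≡T∪⁅y⁆ : T ≡ T ∪ ⁅ y ⁆
  T≡T∪⁅y⁆ = maximal _ (Interesting-∪⁅⁆ G int t∈T ty Ca Cb ab ya yb) (p⊆p∪q ⁅ y ⁆)

module CoComponent {n} (G : Graph n) {T H : Subset n}
                   (maxT : MaximalInteresting G T)
                   (compH : IsComponent (compl G) (InC G T) H) where

  F : Graph n
  F = compl G

  T-nonempty : ∃ (_∈ T)
  T-nonempty = proj₁ (proj₁ maxT)

  T-coconnected : Connected F (mem T)
  T-coconnected = proj₁ (proj₂ (proj₁ maxT))

  H⊆C : ∀ {h} → h ∈ H → InC G T h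
  H⊆C = proj₁ compH _

  H-nonempty : ∃ (_∈ H)
  H-nonempty = proj₁ (proj₂ compH)

  H-connected : Connected F (mem H)
  H-connected = proj₁ (proj₂ (proj₂ compH))

  H-closed : ∀ x y → x ∈ H → InC G T y → Adj F x y → y ∈ H
  H-closed = proj₂ (proj₂ (proj₂ compH))

  T-nonadj-H : ∀ {t h} → t ∈ T → h ∈ H → ¬ Adj F t h
  T-nonadj-H t∈T h∈H (_ , ¬th) = ¬th (proj₂ (H⊆C h∈H) _ t∈T)

  T-outside-NH : ∀ {t} → t ∈ T → ¬ InN F H t
  T-outside-NH t∈T (_ , h , h∈H , ht) = T-nonadj-H t∈T h∈H (sym F ht)

  T≢H : T ≢ H
  T≢H T≡H with T-nonempty
  ... | t , t∈T = proj₁ (H⊆C (subst (t ∈_) T≡H t∈T)) t∈T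

  absorbs : ∀ {x y t v} → x ∈ H → y ∈ H → Adj F x y →
            t ∈ T → Adj F t v → Adj G v x → Adj G v y → v ∈ T
  absorbs x∈H y∈H xy t∈T tv vx vy = maximal-absorbs G maxT t∈T tv (H⊆C x∈H) (H⊆C y∈H) xy vx vy

  NH⊆NT : ∀ {v} → InN F H v → InN F T v
  NH⊆NT {v} v∈NH@(v∉H , h , h∈H , hv) = decidable-stable (InN? F T v) λ v∉NT →
    v∉H (H-closed h v h∈H (¬InN-compl⇒InC G v∉T v∉NT) hv)
    where
    v∉T : v ∉ T
    v∉T v∈T = T-outside-NH v∈T v∈NH

  handle-adjacency : ∀ v → InN F H v → ∀ x y → x ∈ H → y ∈ H → Adj F x y →
                     Adj F v x ⊎ Adj F v y
  handle-adjacency v v∈NH@(v∉H , _) x y x∈H y∈H xy with adj? G v x | adj? G v y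
  ... | no ¬vx | _      = inj₁ ((λ { refl → v∉H x∈H }) , ¬vx)
  ... | yes _  | no ¬vy = inj₂ ((λ { refl → v∉H y∈H }) , ¬vy)
  ... | yes vx | yes vy with NH⊆NT v∈NH
  ...   | v∉T , t , t∈T , tv = contradiction (absorbs x∈H y∈H xy t∈T tv vx vy) v∉T

  module _ (∣H∣≥2 : ∣ H ∣ ≥ 2) where

    T-closed-outside-NH : ∀ x y → x ∈ T → ¬ InN F H y → Adj F x y → y ∈ T
    T-closed-outside-NH x y x∈T y∉NH xy with ∃-edge H-connected H-nonempty ∣H∣≥2
    ... | a , b , a∈H , b∈H , ab = absorbs a∈H b∈H ab x∈T xy (H-adj a∈H) (H-adj b∈H)
      where
      y∉H : y ∉ H
      y∉H y∈H = T-nonadj-H x∈T y∈H xy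
      H-adj : ∀ {c} → c ∈ H → Adj G y c
      H-adj c∈H = sym G (proj₂ (¬InN-compl⇒InC G y∉H y∉NH) _ c∈H)

    NT⊆NH : ∀ {v} → InN F T v → InN F H v
    NT⊆NH {v} (v∉T , t , t∈T , tv) =
      decidable-stable (InN? F H v) λ v∉NH → v∉T (T-closed-outside-NH t v t∈T v∉NH tv)

    T-co-handle : IsCoHandle F H T
    T-co-handle = T-component , T≢H , λ v → NT⊆NH , NH⊆NT
      where
      T-component : IsComponent F (λ v → ¬ InN F H v) T
      T-component = (λ _ → T-outside-NH) , T-nonempty , T-coconnected , T-closed-outside-NH

lemma16 : ∀ {n} (G : Graph n) T H → MaximalInteresting G T
          → IsComponent (compl G) (InC G T) H → ∣ H ∣ ≥ 2
          → IsHandle (compl G) H × IsCoHandle (compl G) H T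
lemma16 G T H maxT compH ∣H∣≥2 =
  (∣H∣≥2 , H-connected , (T , T-co-handle ∣H∣≥2) , handle-adjacency) , T-co-handle ∣H∣≥2
  where open CoComponent G maxT compH
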